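{- Let $\mathbf N$ be a structure and let $\phi(\bar x,y)$ be a formula in a language $\mathcal L^+$ expanding the language of $\mathbf N$ by additional unary predicates. Suppose that for every integer $k$ there are tuples $\bar m_1,\dots,\bar m_k\in N^{\bar x}$, elements $a_{ij}\in N$ for $1\le i<j\le k$, and an expansion $\mathbf N^+$ of $\mathbf N$ to $\mathcal L^+$ (interpreting the new unary predicates) such that $\mathbf N^+\models\phi(\bar m_\ell,a_{ij})\iff \ell\in\{i,j\}$ for all $\ell\in[k]$ and $i<j$. Then $\mathbf N$ is not monadically dependent. Moreover, if $\phi$ is an existential formula then $\mathbf N$ is not existentially monadically dependent.
   Context: A structure is monadically dependent if there is no formula $\psi(\bar x;\bar y)$ in its language expanded by unary predicates such that for every $K$ there is an expansion by unary predicates and tuples $(\bar a_i)_{i\in[K]}$, $(\bar b_J)_{J\subseteq[K]}$ with $\psi(\bar a_i;\bar b_J)\iff i\in J$; it is existentially monadically dependent if the same holds for existential formulas $\psi$ (equivalently, no such formula interprets arbitrary finite graphs on tuples in unary expansions). -}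

module Defs where

open import Data.Nat using (ℕ; zero; suc; _+_)
open import Data.Fin using (Fin; zero; suc; splitAt; _<_)
open import Data.Fin.Subset using (Subset; _∈_)
open import Data.Vec using (Vec; []; _∷_)
open import Data.Sum using (_⊎_; inj₁; inj₂; [_,_])
open import Data.Product using (Σ; Σ-syntax; _×_)
open import Data.Empty using (⊥)
open import Relation.Nullary using (¬_)
open import Relation.Binary.PropositionalEquality using (_≡_)
open import Function.Bundles using (_⇔_)

record Signature : Set₁ where
  field
    FunSym : Set
    funAr  : FunSym → ℕ
    RelSym : Set
    relAr  : RelSym → ℕ
open Signature public

_⁺_ : Signature → Set → Signature
Sig ⁺ U = record
  { FunSym = FunSym Sig
  ; funAr  = funAr Sig
  ; RelSym = RelSym Sig ⊎ U
  ; relAr  = [ relAr Sig , (λ _ → 1) ]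
  }

record Structure (Sig : Signature) : Set₁ where
  field
    Carrier : Set
    funI    : (f : FunSym Sig) → Vec Carrier (funAr Sig f) → Carrier
    relI    : (r : RelSym Sig) → Vec Carrier (relAr Sig r) → Set
open Structure public

expandBy : {Sig : Signature} {U : Set} (N : Structure Sig) →
           (U → Carrier N → Set) → Structure (Sig ⁺ U)
expandBy {Sig} {U} N P = record
  { Carrier = Carrier N
  ; funI    = funI N
  ; relI    = rel
  }
  where
  rel : (r : RelSym Sig ⊎ U) → Vec (Carrier N) (relAr (Sig ⁺ U) r) → Set
  rel (inj₁ r) xs        = relI N r xs
  rel (inj₂ u) (x ∷ [])  = P u x

-- Terms and formulas with n free variables (de Bruijn, binder = zero)

data Term (Sig : Signature) (n : ℕ) : Set where
  var : Fin n → Term Sig n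
  app : (f : FunSym Sig) → Vec (Term Sig n) (funAr Sig f) → Term Sig n

data Formula (Sig : Signature) : ℕ → Set where
  rel   : ∀ {n} (r : RelSym Sig) → Vec (Term Sig n) (relAr Sig r) → Formula Sig n
  equal : ∀ {n} → Term Sig n → Term Sig n → Formula Sig n
  falsum : ∀ {n} → Formula Sig n
  neg   : ∀ {n} → Formula Sig n → Formula Sig n
  conj  : ∀ {n} → Formula Sig n → Formula Sig n → Formula Sig n
  disj  : ∀ {n} → Formula Sig n → Formula Sig n → Formula Sig n
  impl  : ∀ {n} → Formula Sig n → Formula Sig n → Formula Sig n
  ex    : ∀ {n} → Formula Sig (suc n) → Formula Sig n
  all   : ∀ {n} → Formula Sig (suc n) → Formula Sig n

data QF {Sig : Signature} : ∀ {n} → Formula Sig n → Set where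
  rel   : ∀ {n} r ts → QF {n = n} (rel r ts)
  equal : ∀ {n} s t → QF {n = n} (equal s t)
  falsum : ∀ {n} → QF {n = n} falsum
  neg   : ∀ {n} {φ : Formula Sig n} → QF φ → QF (neg φ)
  conj  : ∀ {n} {φ ψ : Formula Sig n} → QF φ → QF ψ → QF (conj φ ψ)
  disj  : ∀ {n} {φ ψ : Formula Sig n} → QF φ → QF ψ → QF (disj φ ψ)
  impl  : ∀ {n} {φ ψ : Formula Sig n} → QF φ → QF ψ → QF (impl φ ψ)

data Existential {Sig : Signature} : ∀ {n} → Formula Sig n → Set where
  qf : ∀ {n} {φ : Formula Sig n} → QF φ → Existential φ
  ex : ∀ {n} {φ : Formula Sig (suc n)} → Existential φ → Existential (ex φ)

extend : {A : Set} {n : ℕ} → (Fin n → A) → A → Fin (suc n) → A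
extend ρ a zero    = a
extend ρ a (suc i) = ρ i

module _ {Sig : Signature} (M : Structure Sig) where
  mutual
    eval : ∀ {n} → (Fin n → Carrier M) → Term Sig n → Carrier M
    eval ρ (var i)    = ρ i
    eval ρ (app f ts) = funI M f (evalVec ρ ts)

    evalVec : ∀ {n k} → (Fin n → Carrier M) → Vec (Term Sig n) k → Vec (Carrier M) k
    evalVec ρ []       = []
    evalVec ρ (t ∷ ts) = eval ρ t ∷ evalVec ρ ts

  Sat : ∀ {n} → Formula Sig n → (Fin n → Carrier M) → Set
  Sat (rel r ts)  ρ = relI M r (evalVec ρ ts)
  Sat (equal s t) ρ = eval ρ s ≡ eval ρ t
  Sat falsum      ρ = ⊥
  Sat (neg φ)     ρ = ¬ Sat φ ρ
  Sat (conj φ ψ)  ρ = Sat φ ρ × Sat ψ ρ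
  Sat (disj φ ψ)  ρ = Sat φ ρ ⊎ Sat ψ ρ
  Sat (impl φ ψ)  ρ = Sat φ ρ → Sat ψ ρ
  Sat (ex φ)      ρ = Σ[ a ∈ Carrier M ] Sat φ (extend ρ a)
  Sat (all φ)     ρ = (a : Carrier M) → Sat φ (extend ρ a)

-- Assignment for a formula ψ(x̄; ȳ) with free variables Fin (n + m):
-- the first n variables are x̄, the last m are ȳ.
pairEnv : {A : Set} {n m : ℕ} → (Fin n → A) → (Fin m → A) → Fin (n + m) → A
pairEnv {n = n} x y i = [ x , y ] (splitAt n i)

IndependenceInExpansions : {Sig : Signature} (N : Structure Sig) (U : Set)
  (n m : ℕ) → Formula (Sig ⁺ U) (n + m) → Set₁
IndependenceInExpansions N U n m ψ =
  (K : ℕ) →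
  Σ[ P ∈ (U → Carrier N → Set) ]
  Σ[ a ∈ (Fin K → Fin n → Carrier N) ]
  Σ[ b ∈ (Subset K → Fin m → Carrier N) ]
  ((i : Fin K) (J : Subset K) →
     Sat (expandBy N P) ψ (pairEnv (a i) (b J)) ⇔ (i ∈ J))

MonadicallyDependent : {Sig : Signature} → Structure Sig → Set₁
MonadicallyDependent {Sig} N =
  ¬ (Σ[ U ∈ Set ] Σ[ n ∈ ℕ ] Σ[ m ∈ ℕ ] Σ[ ψ ∈ Formula (Sig ⁺ U) (n + m) ]
       IndependenceInExpansions N U n m ψ)

ExistentiallyMonadicallyDependent : {Sig : Signature} → Structure Sig → Set₁
ExistentiallyMonadicallyDependent {Sig} N =
  ¬ (Σ[ U ∈ Set ] Σ[ n ∈ ℕ ] Σ[ m ∈ ℕ ] Σ[ ψ ∈ Formula (Sig ⁺ U) (n + m) ]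
       (Existential ψ × IndependenceInExpansions N U n m ψ))

PairPattern : {Sig : Signature} (N : Structure Sig) (U : Set) {n : ℕ} →
  Formula (Sig ⁺ U) (n + 1) → Set₁
PairPattern N U {n} φ =
  (k : ℕ) →
  Σ[ mt ∈ (Fin k → Fin n → Carrier N) ]
  Σ[ a ∈ (Fin k → Fin k → Carrier N) ]
  Σ[ P ∈ (U → Carrier N → Set) ]
  ((ℓ i j : Fin k) → i < j →
     Sat (expandBy N P) φ (pairEnv (mt ℓ) (λ _ → a i j)) ⇔ (ℓ ≡ i ⊎ ℓ ≡ j))

{-# OPTIONS --safe #-}
-- Let ψ(x̄; x̄') say that some y in a new unary predicate Q satisfies φ(x̄, y) ∧ φ(x̄', y).
-- Given K, use the hypothesis with k = K + 2 ^ K, reading the first K indices as elements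
-- i of [K] and the remaining 2 ^ K as subsets J of [K], and let Q be the set of the a_{iJ}
-- with i ∈ J. Since a_{i'J'} is φ-related to m̄_ℓ only for ℓ ∈ {i', J'}, the tuples m̄_i
-- and m̄_J have a common witness in Q iff i ∈ J. If φ is existential, so is ψ after the
-- quantifiers of both copies of φ are pulled to the front.
module Submission where

open import Defs
open import Data.Nat using (ℕ; _+_)
open import Data.Product using (_×_)
open import Relation.Nullary using (¬_)

open import Data.Empty using (⊥; ⊥-elim)
open import Data.Fin using (Fin; zero; suc; splitAt; lift; combine; toℕ; _↑ˡ_; _↑ʳ_; _<_)
open import Data.Fin.Properties
  using (2↔Bool; splitAt-↑ˡ; splitAt-↑ʳ; toℕ-↑ˡ; toℕ-↑ʳ; toℕ<n; ↑ˡ-injective; ↑ʳ-injective;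
         combine-injective; <-irrefl; <-asym)
open import Data.Fin.Subset using (Subset; _∈_)
import Data.Nat as ℕ
open import Data.Nat using (_^_)
open import Data.Nat.Properties using (<-≤-trans; m≤m+n)
open import Data.Product using (Σ-syntax; ∃-syntax; _,_)
import Data.Product.Function.Dependent.Propositional as Σ
open import Data.Product.Function.NonDependent.Propositional using (_×-⇔_)
open import Data.Sum using (_⊎_; inj₁; inj₂; [_,_]′)
open import Data.Sum.Function.Propositional using (_⊎-⇔_)
open import Data.Unit using (⊤; tt)
open import Data.Vec using (Vec; []; _∷_)
open import Function using (_∘_; id; const)
open import Function.Bundles using (_⇔_; mk⇔; Equivalence; Inverse; Injection)
open import Function.Construct.Identity using (⇔-id)
open import Function.Construct.Symmetry using (↔-sym)
import Function.Properties.Equivalence as ⇔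
open import Function.Properties.Inverse using (↔⇒↣)
open import Function.Related.Propositional using (≡⇒)
open import Function.Related.TypeIsomorphisms using (→-cong-⇔; ¬-cong-⇔)
open import Relation.Binary.PropositionalEquality using (_≡_; refl; cong; cong₂; _≗_)

open Equivalence using (to; from)

Π-cong-⇔ : {A : Set} {B C : A → Set} →
           (∀ a → B a ⇔ C a) → ((a : A) → B a) ⇔ ((a : A) → C a)
Π-cong-⇔ B⇔C = mk⇔ (λ f a → to (B⇔C a) (f a)) (λ f a → from (B⇔C a) (f a))

extend-lift : {A : Set} {n m : ℕ} {f : Fin n → Fin m} {ρ : Fin m → A} {σ : Fin n → A} →
              ρ ∘ f ≗ σ → ∀ a → extend ρ a ∘ lift 1 f ≗ extend σ a
extend-lift ρf≗σ a zero    = refl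
extend-lift ρf≗σ a (suc i) = ρf≗σ i

module _ {Sig : Signature} {U V : Set} (g : U → V) where

  mutual
    translateTerm : ∀ {n m} → (Fin n → Fin m) → Term (Sig ⁺ U) n → Term (Sig ⁺ V) m
    translateTerm f (var i)    = var (f i)
    translateTerm f (app h ts) = app h (translateTerms f ts)

    translateTerms : ∀ {n m k} → (Fin n → Fin m) →
                     Vec (Term (Sig ⁺ U) n) k → Vec (Term (Sig ⁺ V) m) k
    translateTerms f []       = []
    translateTerms f (t ∷ ts) = translateTerm f t ∷ translateTerms f ts

  translate : ∀ {n m} → (Fin n → Fin m) → Formula (Sig ⁺ U) n → Formula (Sig ⁺ V) m
  translate f (rel (inj₁ r) ts)       = rel (inj₁ r) (translateTerms f ts)
  translate f (rel (inj₂ u) (t ∷ [])) = rel (inj₂ (g u)) (translateTerm f t ∷ [])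
  translate f (equal s t)             = equal (translateTerm f s) (translateTerm f t)
  translate f falsum                  = falsum
  translate f (neg φ)                 = neg (translate f φ)
  translate f (conj φ ψ)              = conj (translate f φ) (translate f ψ)
  translate f (disj φ ψ)              = disj (translate f φ) (translate f ψ)
  translate f (impl φ ψ)              = impl (translate f φ) (translate f ψ)
  translate f (ex φ)                  = ex (translate (lift 1 f) φ)
  translate f (all φ)                 = all (translate (lift 1 f) φ)

  translate-QF : ∀ {n m} (f : Fin n → Fin m) {φ : Formula (Sig ⁺ U) n} →
                 QF φ → QF (translate f φ)
  translate-QF f (rel (inj₁ r) ts)       = rel _ _
  translate-QF f (rel (inj₂ u) (t ∷ [])) = rel _ _
  translate-QF f (equal s t)             = equal _ _
  translate-QF f falsum                  = falsum
  translate-QF f (neg q)                 = neg (translate-QF f q)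
  translate-QF f (conj q r)              = conj (translate-QF f q) (translate-QF f r)
  translate-QF f (disj q r)              = disj (translate-QF f q) (translate-QF f r)
  translate-QF f (impl q r)              = impl (translate-QF f q) (translate-QF f r)

  translate-existential : ∀ {n m} (f : Fin n → Fin m) {φ : Formula (Sig ⁺ U) n} →
                          Existential φ → Existential (translate f φ)
  translate-existential f (qf q) = qf (translate-QF f q)
  translate-existential f (ex e) = ex (translate-existential (lift 1 f) e)

  module _ (N : Structure Sig) (P : V → Carrier N → Set) where

    mutual
      eval-translateTerm : ∀ {n m} {f : Fin n → Fin m} {ρ σ} → ρ ∘ f ≗ σ →
        ∀ t → eval (expandBy N P) ρ (translateTerm f t) ≡ eval (expandBy N (P ∘ g)) σ t
      eval-translateTerm ρf≗σ (var i)    = ρf≗σ i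
      eval-translateTerm ρf≗σ (app h ts) = cong (funI N h) (evalVec-translateTerms ρf≗σ ts)

      evalVec-translateTerms : ∀ {n m k} {f : Fin n → Fin m} {ρ σ} → ρ ∘ f ≗ σ →
        (ts : Vec (Term (Sig ⁺ U) n) k) →
        evalVec (expandBy N P) ρ (translateTerms f ts) ≡ evalVec (expandBy N (P ∘ g)) σ ts
      evalVec-translateTerms ρf≗σ []       = refl
      evalVec-translateTerms ρf≗σ (t ∷ ts) =
        cong₂ _∷_ (eval-translateTerm ρf≗σ t) (evalVec-translateTerms ρf≗σ ts)

    Sat-translate : ∀ {n m} (φ : Formula (Sig ⁺ U) n) {f : Fin n → Fin m} {ρ σ} → ρ ∘ f ≗ σ →
      Sat (expandBy N P) (translate f φ) ρ ⇔ Sat (expandBy N (P ∘ g)) φ σ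
    Sat-translate (rel (inj₁ r) ts) ρf≗σ =
      ≡⇒ (cong (relI N r) (evalVec-translateTerms ρf≗σ ts))
    Sat-translate (rel (inj₂ u) (t ∷ [])) ρf≗σ =
      ≡⇒ (cong (P (g u)) (eval-translateTerm ρf≗σ t))
    Sat-translate (equal s t) ρf≗σ =
      ≡⇒ (cong₂ _≡_ (eval-translateTerm ρf≗σ s) (eval-translateTerm ρf≗σ t))
    Sat-translate falsum     ρf≗σ = ⇔-id ⊥
    Sat-translate (neg φ)    ρf≗σ = ¬-cong-⇔ (Sat-translate φ ρf≗σ)
    Sat-translate (conj φ ψ) ρf≗σ = Sat-translate φ ρf≗σ ×-⇔ Sat-translate ψ ρf≗σ
    Sat-translate (disj φ ψ) ρf≗σ = Sat-translate φ ρf≗σ ⊎-⇔ Sat-translate ψ ρf≗σ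
    Sat-translate (impl φ ψ) ρf≗σ = →-cong-⇔ (Sat-translate φ ρf≗σ) (Sat-translate ψ ρf≗σ)
    Sat-translate (ex φ)     ρf≗σ = Σ.congˡ (Sat-translate φ (extend-lift ρf≗σ _))
    Sat-translate (all φ)    ρf≗σ = Π-cong-⇔ (λ a → Sat-translate φ (extend-lift ρf≗σ a))

module _ {Sig : Signature} {V : Set} where

  weaken : ∀ {n} → Formula (Sig ⁺ V) n → Formula (Sig ⁺ V) (ℕ.suc n)
  weaken = translate id suc

  Sat-weaken : (N : Structure Sig) (P : V → Carrier N → Set) {n : ℕ}
               (φ : Formula (Sig ⁺ V) n) (ρ : Fin n → Carrier N) (a : Carrier N) →
               Sat (expandBy N P) (weaken φ) (extend ρ a) ⇔ Sat (expandBy N P) φ ρ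
  Sat-weaken N P φ ρ a = Sat-translate id N P φ (λ _ → refl)

  conjPrenexQF : ∀ {n} {θ χ : Formula (Sig ⁺ V) n} → QF θ → Existential χ → Formula (Sig ⁺ V) n
  conjPrenexQF {θ = θ} _ (qf {φ = χ} _) = conj θ χ
  conjPrenexQF q (ex e) = ex (conjPrenexQF (translate-QF id suc q) e)

  conjPrenex : ∀ {n} {φ χ : Formula (Sig ⁺ V) n} → Existential φ → Existential χ → Formula (Sig ⁺ V) n
  conjPrenex (qf q) e  = conjPrenexQF q e
  conjPrenex (ex e) e′ = ex (conjPrenex e (translate-existential id suc e′))

  conjPrenexQF-existential : ∀ {n} {θ χ : Formula (Sig ⁺ V) n} (q : QF θ) (e : Existential χ) →
                             Existential (conjPrenexQF q e)
  conjPrenexQF-existential q (qf r) = qf (conj q r)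
  conjPrenexQF-existential q (ex e) = ex (conjPrenexQF-existential (translate-QF id suc q) e)

  conjPrenex-existential : ∀ {n} {φ χ : Formula (Sig ⁺ V) n} (e : Existential φ) (e′ : Existential χ) →
                           Existential (conjPrenex e e′)
  conjPrenex-existential (qf q) e  = conjPrenexQF-existential q e
  conjPrenex-existential (ex e) e′ = ex (conjPrenex-existential e (translate-existential id suc e′))

  module _ (N : Structure Sig) (P : V → Carrier N → Set) where

    private
      M : Structure (Sig ⁺ V)
      M = expandBy N P

    Sat-conjPrenexQF : ∀ {n} {θ χ : Formula (Sig ⁺ V) n} (q : QF θ) (e : Existential χ) ρ →
                       Sat M (conjPrenexQF q e) ρ ⇔ (Sat M θ ρ × Sat M χ ρ)
    Sat-conjPrenexQF q (qf _) ρ = ⇔-id _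
    Sat-conjPrenexQF {θ = θ} q (ex {φ = χ} e) ρ = mk⇔
      (λ (a , s) → let (sθ , sχ) = to (IH a) s in to (Sat-weaken N P θ ρ a) sθ , (a , sχ))
      (λ (sθ , (a , sχ)) → a , from (IH a) (from (Sat-weaken N P θ ρ a) sθ , sχ))
      where
      IH : ∀ a → Sat M (conjPrenexQF (translate-QF id suc q) e) (extend ρ a) ⇔
                 (Sat M (weaken θ) (extend ρ a) × Sat M χ (extend ρ a))
      IH a = Sat-conjPrenexQF (translate-QF id suc q) e (extend ρ a)

    Sat-conjPrenex : ∀ {n} {φ χ : Formula (Sig ⁺ V) n} (e : Existential φ) (e′ : Existential χ) ρ →
                     Sat M (conjPrenex e e′) ρ ⇔ (Sat M φ ρ × Sat M χ ρ)
    Sat-conjPrenex (qf q) e ρ = Sat-conjPrenexQF q e ρ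
    Sat-conjPrenex {χ = χ} (ex {φ = φ} e) e′ ρ = mk⇔
      (λ (a , s) → let (sφ , sχ) = to (IH a) s in (a , sφ) , to (Sat-weaken N P χ ρ a) sχ)
      (λ ((a , sφ) , sχ) → a , from (IH a) (sφ , from (Sat-weaken N P χ ρ a) sχ))
      where
      IH : ∀ a → Sat M (conjPrenex e (translate-existential id suc e′)) (extend ρ a) ⇔
                 (Sat M φ (extend ρ a) × Sat M (weaken χ) (extend ρ a))
      IH a = Sat-conjPrenex e (translate-existential id suc e′) (extend ρ a)

pairEnv-↑ˡ : {A : Set} {n m : ℕ} (x : Fin n → A) (x′ : Fin m → A) → pairEnv x x′ ∘ (_↑ˡ m) ≗ x
pairEnv-↑ˡ {n = n} {m} x x′ j rewrite splitAt-↑ˡ n j m = refl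

pairEnv-↑ʳ : {A : Set} {n m : ℕ} (x : Fin n → A) (x′ : Fin m → A) → pairEnv x x′ ∘ (n ↑ʳ_) ≗ x′
pairEnv-↑ʳ {n = n} {m} x x′ j rewrite splitAt-↑ʳ n m j = refl

withWitness : {n m : ℕ} → (Fin n → Fin m) → Fin (n + 1) → Fin (ℕ.suc m)
withWitness {n} h = [ suc ∘ h , const zero ]′ ∘ splitAt n

extend-withWitness : {A : Set} {n m : ℕ} {h : Fin n → Fin m} {ρ : Fin m → A} {x : Fin n → A} →
                     ρ ∘ h ≗ x → ∀ y → extend ρ y ∘ withWitness h ≗ pairEnv x (const y)
extend-withWitness {n = n} ρh≗x y i with splitAt n i
... | inj₁ j = ρh≗x j
... | inj₂ _ = refl

module MarkedCommonWitness {Sig : Signature} {U : Set} {n : ℕ} (φ : Formula (Sig ⁺ U) (n + 1)) where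

  DefinesMarkedCommonWitness : Formula (Sig ⁺ (U ⊎ ⊤)) (n + n) → Set₁
  DefinesMarkedCommonWitness ψ =
    (N : Structure Sig) (P : U → Carrier N → Set) (Q : Carrier N → Set)
    (x x′ : Fin n → Carrier N) →
    Sat (expandBy N [ P , const Q ]′) ψ (pairEnv x x′) ⇔
    (∃[ y ] Q y × Sat (expandBy N P) φ (pairEnv x (const y))
               × Sat (expandBy N P) φ (pairEnv x′ (const y)))

  marked : Formula (Sig ⁺ (U ⊎ ⊤)) (ℕ.suc (n + n))
  marked = rel (inj₂ (inj₂ tt)) (var zero ∷ [])

  φˡ φʳ : Formula (Sig ⁺ (U ⊎ ⊤)) (ℕ.suc (n + n))
  φˡ = translate inj₁ (withWitness (_↑ˡ n)) φ
  φʳ = translate inj₁ (withWitness (n ↑ʳ_)) φ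

  isMarkedCommonWitness : Formula (Sig ⁺ (U ⊎ ⊤)) (ℕ.suc (n + n))
  isMarkedCommonWitness = conj marked (conj φˡ φʳ)

  Sat-isMarkedCommonWitness : (N : Structure Sig) (P : U → Carrier N → Set) (Q : Carrier N → Set)
    (x x′ : Fin n → Carrier N) (y : Carrier N) →
    Sat (expandBy N [ P , const Q ]′) isMarkedCommonWitness (extend (pairEnv x x′) y) ⇔
    (Q y × Sat (expandBy N P) φ (pairEnv x (const y)) × Sat (expandBy N P) φ (pairEnv x′ (const y)))
  Sat-isMarkedCommonWitness N P Q x x′ y =
    ⇔-id (Q y)
      ×-⇔ Sat-translate inj₁ N [ P , const Q ]′ φ (extend-withWitness (pairEnv-↑ˡ x x′) y)
      ×-⇔ Sat-translate inj₁ N [ P , const Q ]′ φ (extend-withWitness (pairEnv-↑ʳ x x′) y)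

  hasMarkedCommonWitness : Formula (Sig ⁺ (U ⊎ ⊤)) (n + n)
  hasMarkedCommonWitness = ex isMarkedCommonWitness

  hasMarkedCommonWitness-defines : DefinesMarkedCommonWitness hasMarkedCommonWitness
  hasMarkedCommonWitness-defines N P Q x x′ = Σ.congˡ (Sat-isMarkedCommonWitness N P Q x x′ _)

  module _ (e : Existential φ) where

    private
      markedQF : QF marked
      markedQF = rel _ _

      eˡ : Existential φˡ
      eˡ = translate-existential inj₁ _ e

      eʳ : Existential φʳ
      eʳ = translate-existential inj₁ _ e

    isMarkedCommonWitnessᵉ : Formula (Sig ⁺ (U ⊎ ⊤)) (ℕ.suc (n + n))
    isMarkedCommonWitnessᵉ = conjPrenex (qf markedQF) (conjPrenex-existential eˡ eʳ)

    Sat-isMarkedCommonWitnessᵉ : (N : Structure Sig) (P : U ⊎ ⊤ → Carrier N → Set)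
      (ρ : Fin (ℕ.suc (n + n)) → Carrier N) →
      Sat (expandBy N P) isMarkedCommonWitnessᵉ ρ ⇔ Sat (expandBy N P) isMarkedCommonWitness ρ
    Sat-isMarkedCommonWitnessᵉ N P ρ =
      ⇔.trans (Sat-conjPrenex N P (qf markedQF) (conjPrenex-existential eˡ eʳ) ρ)
              (⇔-id _ ×-⇔ Sat-conjPrenex N P eˡ eʳ ρ)

    hasMarkedCommonWitnessᵉ : Formula (Sig ⁺ (U ⊎ ⊤)) (n + n)
    hasMarkedCommonWitnessᵉ = ex isMarkedCommonWitnessᵉ

    hasMarkedCommonWitnessᵉ-existential : Existential hasMarkedCommonWitnessᵉ
    hasMarkedCommonWitnessᵉ-existential =
      ex (conjPrenex-existential (qf markedQF) (conjPrenex-existential eˡ eʳ))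

    hasMarkedCommonWitnessᵉ-defines : DefinesMarkedCommonWitness hasMarkedCommonWitnessᵉ
    hasMarkedCommonWitnessᵉ-defines N P Q x x′ =
      Σ.congˡ (⇔.trans (Sat-isMarkedCommonWitnessᵉ N _ _) (Sat-isMarkedCommonWitness N P Q x x′ _))

-- A pair pattern together with a unary predicate encodes any graph

<-endpoints : {k : ℕ} {ℓ ℓ′ i j : Fin k} → i < j → ℓ < ℓ′ →
              ℓ ≡ i ⊎ ℓ ≡ j → ℓ′ ≡ i ⊎ ℓ′ ≡ j → ℓ ≡ i × ℓ′ ≡ j
<-endpoints _   _    (inj₁ ℓ≡i)  (inj₂ ℓ′≡j) = ℓ≡i , ℓ′≡j
<-endpoints _   ℓ<ℓ′ (inj₁ refl) (inj₁ refl) = ⊥-elim (<-irrefl refl ℓ<ℓ′)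
<-endpoints _   ℓ<ℓ′ (inj₂ refl) (inj₂ refl) = ⊥-elim (<-irrefl refl ℓ<ℓ′)
<-endpoints i<j ℓ<ℓ′ (inj₂ refl) (inj₁ refl) = ⊥-elim (<-asym i<j ℓ<ℓ′)

module PairPatternGraph {A X : Set} {k : ℕ}
  (E : X → A → Set) (m : Fin k → X) (a : Fin k → Fin k → A)
  (encodesPairs : ∀ ℓ i j → i < j → E (m ℓ) (a i j) ⇔ (ℓ ≡ i ⊎ ℓ ≡ j))
  {Edge : Set} (src tgt : Edge → Fin k) (src<tgt : ∀ e → src e < tgt e) where

  Marked : A → Set
  Marked y = ∃[ e ] y ≡ a (src e) (tgt e)

  private
    atEdge : ∀ ℓ e → E (m ℓ) (a (src e) (tgt e)) ⇔ (ℓ ≡ src e ⊎ ℓ ≡ tgt e)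
    atEdge ℓ e = encodesPairs ℓ (src e) (tgt e) (src<tgt e)

  markedCommonNeighbour⇔edge : ∀ {ℓ ℓ′} → ℓ < ℓ′ →
    (∃[ y ] Marked y × E (m ℓ) y × E (m ℓ′) y) ⇔ (∃[ e ] src e ≡ ℓ × tgt e ≡ ℓ′)
  markedCommonNeighbour⇔edge {ℓ} {ℓ′} ℓ<ℓ′ = mk⇔ edge neighbour
    where
    edge : (∃[ y ] Marked y × E (m ℓ) y × E (m ℓ′) y) → ∃[ e ] src e ≡ ℓ × tgt e ≡ ℓ′
    edge (_ , (e , refl) , Eℓ , Eℓ′)
      with refl , refl ← <-endpoints (src<tgt e) ℓ<ℓ′ (to (atEdge ℓ e) Eℓ) (to (atEdge ℓ′ e) Eℓ′)
      = e , refl , refl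

    neighbour : (∃[ e ] src e ≡ ℓ × tgt e ≡ ℓ′) → ∃[ y ] Marked y × E (m ℓ) y × E (m ℓ′) y
    neighbour (e , refl , refl) =
      a (src e) (tgt e) , (e , refl) , from (atEdge ℓ e) (inj₁ refl) , from (atEdge ℓ′ e) (inj₂ refl)

encode : {K : ℕ} → Subset K → Fin (2 ^ K)
encode []      = zero
encode (b ∷ J) = combine (Inverse.from 2↔Bool b) (encode J)

encode-injective : {K : ℕ} {I J : Subset K} → encode I ≡ encode J → I ≡ J
encode-injective {I = []}    {[]}    _  = refl
encode-injective {I = b ∷ I} {c ∷ J} eq
  with b≡c , I≡J ← combine-injective _ _ _ _ eq
  = cong₂ _∷_ (Injection.injective (↔⇒↣ (↔-sym 2↔Bool)) b≡c) (encode-injective I≡J)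

module Membership (K : ℕ) where

  Vertex : Set
  Vertex = Fin (K + 2 ^ K)

  left : Fin K → Vertex
  left i = i ↑ˡ 2 ^ K

  right : Subset K → Vertex
  right J = K ↑ʳ encode J

  left<right : ∀ i J → left i < right J
  left<right i J rewrite toℕ-↑ˡ i (2 ^ K) | toℕ-↑ʳ K (encode J) =
    <-≤-trans (toℕ<n i) (m≤m+n K (toℕ (encode J)))

  Edge : Set
  Edge = Σ[ i ∈ Fin K ] Σ[ J ∈ Subset K ] i ∈ J

  src tgt : Edge → Vertex
  src (i , _ , _) = left i
  tgt (_ , J , _) = right J

  edge⇔∈ : ∀ i J → (∃[ e ] src e ≡ left i × tgt e ≡ right J) ⇔ i ∈ J
  edge⇔∈ i J = mk⇔ member (λ i∈J → (i , J , i∈J) , refl , refl)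
    where
    member : (∃[ e ] src e ≡ left i × tgt e ≡ right J) → i ∈ J
    member ((i′ , J′ , i′∈J′) , i′≡i , J′≡J)
      with refl ← ↑ˡ-injective (2 ^ K) i′ i i′≡i
         | refl ← encode-injective {I = J′} {J} (↑ʳ-injective K _ _ J′≡J)
      = i′∈J′

module _ {Sig : Signature} (N : Structure Sig) {U : Set} {n : ℕ} (φ : Formula (Sig ⁺ U) (n + 1))
         (pairPattern : PairPattern N U φ) where

  open MarkedCommonWitness φ using (DefinesMarkedCommonWitness)

  definesMarkedCommonWitness⇒independence : ∀ ψ → DefinesMarkedCommonWitness ψ →
                                            IndependenceInExpansions N (U ⊎ ⊤) n n ψ
  definesMarkedCommonWitness⇒independence ψ defines K with pairPattern (K + 2 ^ K)
  ... | m , a , P , encodesPairs =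
    [ P , const Marked ]′ , m ∘ left , m ∘ right , λ i J →
      ⇔.trans (defines N P Marked (m (left i)) (m (right J)))
              (⇔.trans (markedCommonNeighbour⇔edge (left<right i J)) (edge⇔∈ i J))
    where
    open Membership K
    open PairPatternGraph (λ x y → Sat (expandBy N P) φ (pairEnv x (const y))) m a encodesPairs
                          src tgt (λ (i , J , _) → left<right i J)

mainTheorem13 : {Sig : Signature} (N : Structure Sig) (U : Set) (n : ℕ)
                (φ : Formula (Sig ⁺ U) (n + 1)) →
                PairPattern N U φ →
                ¬ MonadicallyDependent N
                × (Existential φ → ¬ ExistentiallyMonadicallyDependent N)
mainTheorem13 N U n φ pairPattern =
  (λ dependent → dependent
     ((U ⊎ ⊤) , n , n , hasMarkedCommonWitness ,
      independent hasMarkedCommonWitness hasMarkedCommonWitness-defines)) ,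
  (λ e dependent → dependent
     ((U ⊎ ⊤) , n , n , hasMarkedCommonWitnessᵉ e , hasMarkedCommonWitnessᵉ-existential e ,
      independent (hasMarkedCommonWitnessᵉ e) (hasMarkedCommonWitnessᵉ-defines e)))
  where
  open MarkedCommonWitness φ

  independent : ∀ ψ → DefinesMarkedCommonWitness ψ → IndependenceInExpansions N (U ⊎ ⊤) n n ψ
  independent = definesMarkedCommonWitness⇒independence N φ pairPattern
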